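{- Let $n$ be a power of $2$. For $h\in\{0,1,\dots,\log_2 n\}$ and $j\in[n/2^h]$ let $I_{h,j}=\big((j-1)2^h,\, j2^h\big]\cap\mathbb{Z}$ and $x_{h,j}=2^{ -h/2}\sum_{i\in I_{h,j}} e_i\in\mathbb{R}^n$, where $e_i$ is the $i$-th standard basis vector. Let $P=\{x_{h,j}\}$ (a set of $2n-1$ unit vectors) equipped with the Euclidean metric. Then there exists a $1$-navigable directed graph $H=(P,E)$ with maximum out-degree $O(\log n)$.
   Context: For $\alpha\ge 1$, a directed graph $G=(P,E)$ on a finite metric space $(P,\mathsf{d})$ is $\alpha$-navigable if for every $s,t\in P$ with $\mathsf{d}(s,t)>0$ there is $u\in P$ with $(s,u)\in E$ and $\mathsf{d}(u,t)<\mathsf{d}(s,t)/\alpha$. -}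

module Defs where

open import Data.Nat as ℕ using (ℕ; zero; suc; _^_; _∸_)
open import Data.Fin using (Fin; zero; suc; toℕ)
open import Data.Product using (Σ; Σ-syntax; ∃; ∃-syntax; _×_; _,_)
open import Data.Sum using (_⊎_)
open import Data.List using (List; length)
open import Data.List.Membership.Propositional using (_∈_)
open import Data.Bool using (if_then_else_)
open import Relation.Nullary.Decidable using (does; _×-dec_)
open import Data.Rational as Q using (ℚ; 0ℚ; 1ℚ; ½)

-- The ordered field ℚ(√2): a pair (a , b) denotes a + b·√2.
-- All coordinates of the points x_{h,j} lie in ℚ(√2), so the Euclidean
-- squared distance is computed exactly in ℚ(√2).

record ℚ√2 : Set where
  constructor _+_√2
  field
    ra : ℚ
    ir : ℚ
open ℚ√2 public

0√ : ℚ√2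
0√ = 0ℚ + 0ℚ √2

_⊕_ : ℚ√2 → ℚ√2 → ℚ√2
(a + b √2) ⊕ (c + d √2) = (a Q.+ c) + (b Q.+ d) √2

_⊖_ : ℚ√2 → ℚ√2 → ℚ√2
(a + b √2) ⊖ (c + d √2) = (a Q.- c) + (b Q.- d) √2

-- (a + b√2)(c + d√2) = (ac + 2bd) + (ad + bc)√2
_⊗_ : ℚ√2 → ℚ√2 → ℚ√2
(a + b √2) ⊗ (c + d √2) =
  ((a Q.* c) Q.+ ((b Q.* d) Q.+ (b Q.* d))) + ((a Q.* d) Q.+ (b Q.* c)) √2

-- Positivity of a + b√2 (√2 irrational, √2 > 0):
--   a > 0, b ≥ 0;  or a ≥ 0, b > 0;
--   or a > 0, b < 0, a² > 2b²;  or a < 0, b > 0, 2b² > a².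
Pos : ℚ√2 → Set
Pos (a + b √2) =
      (0ℚ Q.< a × 0ℚ Q.≤ b)
    ⊎ (0ℚ Q.≤ a × 0ℚ Q.< b)
    ⊎ (0ℚ Q.< a × b Q.< 0ℚ × ((b Q.* b) Q.+ (b Q.* b)) Q.< (a Q.* a))
    ⊎ (a Q.< 0ℚ × 0ℚ Q.< b × (a Q.* a) Q.< ((b Q.* b) Q.+ (b Q.* b)))

_<√_ : ℚ√2 → ℚ√2 → Set
x <√ y = Pos (y ⊖ x)

-- 1/√2 = (1/2)·√2, and 2^{-h/2} = (1/√2)^h
invSqrt2 : ℚ√2
invSqrt2 = 0ℚ + ½ √2

pow : ℚ√2 → ℕ → ℚ√2
pow x zero = 1ℚ + 0ℚ √2
pow x (suc h) = x ⊗ pow x h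

sumFin : (m : ℕ) → (Fin m → ℚ√2) → ℚ√2
sumFin zero f = 0√
sumFin (suc m) f = f zero ⊕ sumFin m (λ i → f (suc i))

-- A point is x_{h,j} with h ∈ {0,…,k} and
-- j ∈ [n/2^h]; j is stored 0-based (paper's j = stored j + 1), and
-- coordinates i ∈ [n] are 0-based (paper's e_i = coordinate i-1).
-- I_{h,j} = ((j-1)2^h, j2^h] (1-based) becomes {i | j'2^h ≤ i < (j'+1)2^h}.

Point : ℕ → Set
Point k = Σ[ h ∈ Fin (suc k) ] Fin (2 ^ (k ∸ toℕ h))

coord : (k : ℕ) → Point k → Fin (2 ^ k) → ℚ√2
coord k (h , j) i =
  if does ((toℕ j ℕ.* 2 ^ toℕ h) ℕ.≤? toℕ i ×-dec (toℕ i ℕ.<? (suc (toℕ j)) ℕ.* 2 ^ toℕ h))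
  then pow invSqrt2 (toℕ h)
  else 0√

dist² : (k : ℕ) → Point k → Point k → ℚ√2
dist² k p q = sumFin (2 ^ k) (λ i → (coord k p i ⊖ coord k q i) ⊗ (coord k p i ⊖ coord k q i))

Graph : ℕ → Set
Graph k = Point k → List (Point k)

-- 1-navigable: for all s,t with d(s,t) > 0 there is an out-neighbour u of s
-- with d(u,t) < d(s,t).  Since d ≥ 0 and √ is strictly monotone, this is
-- stated with squared distances.
OneNavigable : (k : ℕ) → Graph k → Set
OneNavigable k G =
  ∀ (s t : Point k) → 0√ <√ dist² k s t →
    ∃[ u ] (u ∈ G s × dist² k u t <√ dist² k s t)

MaxOutDegree≤ : (k : ℕ) → Graph k → ℕ → Set
MaxOutDegree≤ k G D = ∀ (s : Point k) → length (G s) ℕ.≤ D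

module Submission where

-- The points are the nodes of the complete binary tree of dyadic blocks, all unit vectors.
-- A block lying d levels below another has inner product 2^(-d/2) with it, and disjoint
-- blocks are orthogonal.  So along a chain of nested blocks ‖x - y‖² = 2 - 2⟨x , y⟩ grows
-- strictly with the number of levels between x and y, and it is maximal (= 2) for disjoint blocks.
-- Each node points to the root, its parent and its two children: towards a target above s
-- step to the parent, towards a target below s step to the child containing it, and
-- towards a disjoint target step to the root, which lies above every block.

open import Defs
open import Data.Nat as ℕ using (ℕ; zero; suc; _*_; _+_; _∸_; _^_; _≤_; _<_; s≤s; _≤?_; _<?_; NonZero; _/_)
import Data.Nat.Properties as ℕP
open import Data.Nat.DivMod
open import Data.Fin as Fin using (Fin; toℕ; fromℕ<)
open import Data.Fin.Properties using (toℕ<n; toℕ-fromℕ<)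
open import Data.Rational as Q using (ℚ; 0ℚ; 1ℚ; ½)
import Data.Rational.Properties as QP
open import Data.Rational.Solver using (module +-*-Solver)
open import Data.Bool using (Bool; true; false; if_then_else_)
open import Data.Bool.Properties using (¬-not)
open import Data.Product using (∃-syntax; _×_; _,_)
open import Data.Sum using (_⊎_; inj₁; inj₂)
open import Data.Empty using (⊥-elim)
open import Data.Unit using (tt)
open import Data.List using (List; _∷_; []; map)
open import Data.List.Relation.Unary.Any as Any using (Any; here; there)
open import Data.List.Relation.Unary.Any.Properties using (map⁺)
open import Data.List.Membership.Propositional using (find)
open import Algebra.Bundles using (CommutativeRing)
open import Algebra.Structures using (IsCommutativeRing)
open import Relation.Binary.Definitions using (Decidable)
open import Relation.Binary.PropositionalEquality
open import Relation.Nullary using (Dec; yes; no; ¬_)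
open import Relation.Nullary.Decidable
  using (does; _×-dec_; _⊎-dec_; dec-true; dec-false; toWitness; toWitnessFalse)

⊝_ : ℚ√2 → ℚ√2
⊝ (a + b √2) = (Q.- a) + (Q.- b) √2

1√ sqrt2 two : ℚ√2
1√ = 1ℚ + 0ℚ √2
sqrt2 = 0ℚ + 1ℚ √2
two = 1√ ⊕ 1√

fromℚ : ℚ → ℚ√2
fromℚ q = q + 0ℚ √2

-- Scopes the ℚ solver, whose names clash with those of the ℚ(√2) solver opened further down.
module _ where
  open +-*-Solver

  ⊕-assoc : ∀ x y z → (x ⊕ y) ⊕ z ≡ x ⊕ (y ⊕ z)
  ⊕-assoc (a + b √2) (c + d √2) (e + f √2) = cong₂ _+_√2 (QP.+-assoc a c e) (QP.+-assoc b d f)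

  ⊕-comm : ∀ x y → x ⊕ y ≡ y ⊕ x
  ⊕-comm (a + b √2) (c + d √2) = cong₂ _+_√2 (QP.+-comm a c) (QP.+-comm b d)

  ⊕-identityˡ : ∀ x → 0√ ⊕ x ≡ x
  ⊕-identityˡ (a + b √2) = cong₂ _+_√2 (QP.+-identityˡ a) (QP.+-identityˡ b)

  ⊕-identityʳ : ∀ x → x ⊕ 0√ ≡ x
  ⊕-identityʳ (a + b √2) = cong₂ _+_√2 (QP.+-identityʳ a) (QP.+-identityʳ b)

  ⊕-inverseˡ : ∀ x → (⊝ x) ⊕ x ≡ 0√
  ⊕-inverseˡ (a + b √2) = cong₂ _+_√2 (QP.+-inverseˡ a) (QP.+-inverseˡ b)

  ⊕-inverseʳ : ∀ x → x ⊕ (⊝ x) ≡ 0√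
  ⊕-inverseʳ (a + b √2) = cong₂ _+_√2 (QP.+-inverseʳ a) (QP.+-inverseʳ b)

  ⊗-comm : ∀ x y → x ⊗ y ≡ y ⊗ x
  ⊗-comm (a + b √2) (c + d √2) = cong₂ _+_√2
    (solve 4 (λ a b c d → a :* c :+ (b :* d :+ b :* d) := c :* a :+ (d :* b :+ d :* b)) refl a b c d)
    (solve 4 (λ a b c d → a :* d :+ b :* c := c :* b :+ d :* a) refl a b c d)

  ⊗-assoc : ∀ x y z → (x ⊗ y) ⊗ z ≡ x ⊗ (y ⊗ z)
  ⊗-assoc (a + b √2) (c + d √2) (e + f √2) = cong₂ _+_√2
    (solve 6 (λ a b c d e f →
       (a :* c :+ (b :* d :+ b :* d)) :* e :+ ((a :* d :+ b :* c) :* f :+ (a :* d :+ b :* c) :* f)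
       := a :* (c :* e :+ (d :* f :+ d :* f)) :+ (b :* (c :* f :+ d :* e) :+ b :* (c :* f :+ d :* e)))
       refl a b c d e f)
    (solve 6 (λ a b c d e f →
       (a :* c :+ (b :* d :+ b :* d)) :* f :+ (a :* d :+ b :* c) :* e
       := a :* (c :* f :+ d :* e) :+ b :* (c :* e :+ (d :* f :+ d :* f)))
       refl a b c d e f)

  ⊗-identityˡ : ∀ x → 1√ ⊗ x ≡ x
  ⊗-identityˡ (a + b √2) = cong₂ _+_√2
    (solve 2 (λ a b → con 1ℚ :* a :+ (con 0ℚ :* b :+ con 0ℚ :* b) := a) refl a b)
    (solve 2 (λ a b → con 1ℚ :* b :+ con 0ℚ :* a := b) refl a b)

  ⊗-identityʳ : ∀ x → x ⊗ 1√ ≡ x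
  ⊗-identityʳ x = trans (⊗-comm x 1√) (⊗-identityˡ x)

  ⊗-distribˡ-⊕ : ∀ x y z → x ⊗ (y ⊕ z) ≡ (x ⊗ y) ⊕ (x ⊗ z)
  ⊗-distribˡ-⊕ (a + b √2) (c + d √2) (e + f √2) = cong₂ _+_√2
    (solve 6 (λ a b c d e f →
       a :* (c :+ e) :+ (b :* (d :+ f) :+ b :* (d :+ f))
       := (a :* c :+ (b :* d :+ b :* d)) :+ (a :* e :+ (b :* f :+ b :* f))) refl a b c d e f)
    (solve 6 (λ a b c d e f →
       a :* (d :+ f) :+ b :* (c :+ e) := (a :* d :+ b :* c) :+ (a :* f :+ b :* e)) refl a b c d e f)

  ⊗-distribʳ-⊕ : ∀ x y z → (y ⊕ z) ⊗ x ≡ (y ⊗ x) ⊕ (z ⊗ x)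
  ⊗-distribʳ-⊕ x y z = begin
    (y ⊕ z) ⊗ x         ≡⟨ ⊗-comm (y ⊕ z) x ⟩
    x ⊗ (y ⊕ z)         ≡⟨ ⊗-distribˡ-⊕ x y z ⟩
    (x ⊗ y) ⊕ (x ⊗ z)   ≡⟨ cong₂ _⊕_ (⊗-comm x y) (⊗-comm x z) ⟩
    (y ⊗ x) ⊕ (z ⊗ x)   ∎
    where open ≡-Reasoning

  fromℚ-⊗ : ∀ q a b → fromℚ q ⊗ (a + b √2) ≡ (q Q.* a) + (q Q.* b) √2
  fromℚ-⊗ q a b = cong₂ _+_√2
    (solve 3 (λ q a b → q :* a :+ (con 0ℚ :* b :+ con 0ℚ :* b) := q :* a) refl q a b)
    (solve 3 (λ q a b → q :* b :+ con 0ℚ :* a := q :* b) refl q a b)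

  invSqrt2⊗fromℚ : ∀ q → invSqrt2 ⊗ fromℚ q ≡ (fromℚ (½ Q.* q) ⊗ sqrt2)
  invSqrt2⊗fromℚ q = cong₂ _+_√2
    (solve 1 (λ q → con 0ℚ :* q :+ (con ½ :* con 0ℚ :+ con ½ :* con 0ℚ)
                    := (con ½ :* q) :* con 0ℚ :+ (con 0ℚ :* con 1ℚ :+ con 0ℚ :* con 1ℚ)) refl q)
    (solve 1 (λ q → con 0ℚ :* con 0ℚ :+ con ½ :* q := (con ½ :* q) :* con 1ℚ :+ con 0ℚ :* con 0ℚ) refl q)

  invSqrt2⊗fromℚ⊗sqrt2 : ∀ q → invSqrt2 ⊗ (fromℚ q ⊗ sqrt2) ≡ fromℚ q
  invSqrt2⊗fromℚ⊗sqrt2 q = cong₂ _+_√2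
    (solve 1 (λ q → con 0ℚ :* (q :* con 0ℚ :+ (con 0ℚ :* con 1ℚ :+ con 0ℚ :* con 1ℚ))
                    :+ (con ½ :* (q :* con 1ℚ :+ con 0ℚ :* con 0ℚ) :+ con ½ :* (q :* con 1ℚ :+ con 0ℚ :* con 0ℚ))
                    := q) refl q)
    (solve 1 (λ q → con 0ℚ :* (q :* con 1ℚ :+ con 0ℚ :* con 0ℚ)
                    :+ con ½ :* (q :* con 0ℚ :+ (con 0ℚ :* con 1ℚ :+ con 0ℚ :* con 1ℚ))
                    := con 0ℚ) refl q)

  Pos-fromℚ⊗ : ∀ {q} x → 0ℚ Q.< q → Pos x → Pos (fromℚ q ⊗ x)
  Pos-fromℚ⊗ {q} (a + b √2) q>0 pos = subst Pos (sym (fromℚ-⊗ q a b)) (scaled pos)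
    where
    instance
      _ = Q.positive q>0
      _ = QP.pos⇒nonNeg q
      _ = QP.pos*pos⇒pos q q
    0<q* : ∀ {x} → 0ℚ Q.< x → 0ℚ Q.< q Q.* x
    0<q* {x} x>0 = subst (Q._< q Q.* x) (QP.*-zeroʳ q) (QP.*-monoʳ-<-pos q x>0)
    q*<0 : ∀ {x} → x Q.< 0ℚ → q Q.* x Q.< 0ℚ
    q*<0 {x} x<0 = subst (q Q.* x Q.<_) (QP.*-zeroʳ q) (QP.*-monoʳ-<-pos q x<0)
    0≤q* : ∀ {x} → 0ℚ Q.≤ x → 0ℚ Q.≤ q Q.* x
    0≤q* {x} x≥0 = subst (Q._≤ q Q.* x) (QP.*-zeroʳ q) (QP.*-monoˡ-≤-nonNeg q x≥0)
    q²*< : ∀ {u v} → u Q.< v → (q Q.* q) Q.* u Q.< (q Q.* q) Q.* v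
    q²*< = QP.*-monoʳ-<-pos (q Q.* q)
    sq : ∀ x → (q Q.* x) Q.* (q Q.* x) ≡ (q Q.* q) Q.* (x Q.* x)
    sq = solve 2 (λ q x → (q :* x) :* (q :* x) := (q :* q) :* (x :* x)) refl q
    dsq : ∀ x → ((q Q.* x) Q.* (q Q.* x)) Q.+ ((q Q.* x) Q.* (q Q.* x)) ≡ (q Q.* q) Q.* ((x Q.* x) Q.+ (x Q.* x))
    dsq = solve 2 (λ q x → (q :* x) :* (q :* x) :+ (q :* x) :* (q :* x) := (q :* q) :* (x :* x :+ x :* x))
            refl q
    scaled : Pos (a + b √2) → Pos ((q Q.* a) + (q Q.* b) √2)
    scaled (inj₁ (a>0 , b≥0))                = inj₁ (0<q* a>0 , 0≤q* b≥0)
    scaled (inj₂ (inj₁ (a≥0 , b>0)))         = inj₂ (inj₁ (0≤q* a≥0 , 0<q* b>0))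
    scaled (inj₂ (inj₂ (inj₁ (a>0 , b<0 , 2b²<a²)))) =
      inj₂ (inj₂ (inj₁ (0<q* a>0 , q*<0 b<0 , subst₂ Q._<_ (sym (dsq b)) (sym (sq a)) (q²*< 2b²<a²))))
    scaled (inj₂ (inj₂ (inj₂ (a<0 , b>0 , a²<2b²)))) =
      inj₂ (inj₂ (inj₂ (q*<0 a<0 , 0<q* b>0 , subst₂ Q._<_ (sym (sq a)) (sym (dsq b)) (q²*< a²<2b²))))

Pos? : ∀ x → Dec (Pos x)
Pos? (a + b √2) =
      (0ℚ QP.<? a ×-dec 0ℚ QP.≤? b)
  ⊎-dec (0ℚ QP.≤? a ×-dec 0ℚ QP.<? b)
  ⊎-dec (0ℚ QP.<? a ×-dec b QP.<? 0ℚ ×-dec (b Q.* b) Q.+ (b Q.* b) QP.<? a Q.* a)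
  ⊎-dec (a QP.<? 0ℚ ×-dec 0ℚ QP.<? b ×-dec a Q.* a QP.<? (b Q.* b) Q.+ (b Q.* b))

ℚ√2-isCommutativeRing : IsCommutativeRing _≡_ _⊕_ _⊗_ ⊝_ 0√ 1√
ℚ√2-isCommutativeRing = record
  { isRing = record
    { +-isAbelianGroup = record
      { isGroup = record
        { isMonoid = record
          { isSemigroup = record
            { isMagma = record { isEquivalence = isEquivalence ; ∙-cong = cong₂ _⊕_ }
            ; assoc = ⊕-assoc }
          ; identity = ⊕-identityˡ , ⊕-identityʳ }
        ; inverse = ⊕-inverseˡ , ⊕-inverseʳ
        ; ⁻¹-cong = cong ⊝_ }
      ; comm = ⊕-comm }
    ; *-cong = cong₂ _⊗_
    ; *-assoc = ⊗-assoc
    ; *-identity = ⊗-identityˡ , ⊗-identityʳ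
    ; distrib = ⊗-distribˡ-⊕ , ⊗-distribʳ-⊕ }
  ; *-comm = ⊗-comm }

ℚ√2-commutativeRing : CommutativeRing _ _
ℚ√2-commutativeRing = record { isCommutativeRing = ℚ√2-isCommutativeRing }

_≟√_ : Decidable {A = ℚ√2} _≡_
(a + b √2) ≟√ (c + d √2) with a QP.≟ c | b QP.≟ d
... | yes refl | yes refl = yes refl
... | no a≢c   | _        = no λ { refl → a≢c refl }
... | yes _    | no b≢d   = no λ { refl → b≢d refl }

open import Algebra.Solver.Ring.AlmostCommutativeRing using (fromCommutativeRing)
open import Algebra.Solver.Ring.Simple (fromCommutativeRing ℚ√2-commutativeRing) _≟√_
  using (solve; _:=_; _:+_; _:*_; _:-_; con)


open CommutativeRing ℚ√2-commutativeRing using (semiring; zeroˡ; zeroʳ)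
open import Algebra.Properties.Semiring.Sum semiring
  using (sum; sum-cong-≗; sum-replicate; sum-replicate-zero; ∑-distrib-+; *-distribˡ-sum)
open import Algebra.Properties.Semiring.Mult semiring using (×-assoc-*; ×1-homo-*) renaming (_×_ to _·_)

⟦_⟧ : ℕ → ℚ√2
⟦ n ⟧ = n · 1√

sumFin≡sum : ∀ n (f : Fin n → ℚ√2) → sumFin n f ≡ sum f
sumFin≡sum zero    f = refl
sumFin≡sum (suc n) f = cong (f Fin.zero ⊕_) (sumFin≡sum n (λ i → f (Fin.suc i)))

sumBelow : ℕ → (ℕ → ℚ√2) → ℚ√2
sumBelow n f = sum {n} (λ i → f (toℕ i))

sumBelow-+ : ∀ m n (f : ℕ → ℚ√2) → sumBelow (m + n) f ≡ (sumBelow m f ⊕ sumBelow n (λ i → f (m + i)))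
sumBelow-+ zero    n f = sym (⊕-identityˡ _)
sumBelow-+ (suc m) n f = trans (cong (f 0 ⊕_) (sumBelow-+ m n (λ i → f (suc i))))
  (sym (⊕-assoc (f 0) (sumBelow m (λ i → f (suc i))) _))

sumBelow-cong : ∀ n {f g : ℕ → ℚ√2} → (∀ i → i < n → f i ≡ g i) → sumBelow n f ≡ sumBelow n g
sumBelow-cong n f≡g = sum-cong-≗ (λ i → f≡g (toℕ i) (toℕ<n i))

sumBelow-zero : ∀ n {f : ℕ → ℚ√2} → (∀ i → i < n → f i ≡ 0√) → sumBelow n f ≡ 0√
sumBelow-zero n f≡0 = trans (sumBelow-cong n f≡0) (sum-replicate-zero n)

sumBelow-const : ∀ n v → sumBelow n (λ _ → v) ≡ (⟦ n ⟧ ⊗ v)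
sumBelow-const n v = begin
  sumBelow n (λ _ → v)  ≡⟨ sum-replicate n ⟩
  n · v                 ≡⟨ cong (n ·_) (⊗-identityˡ v) ⟨
  n · (1√ ⊗ v)          ≡⟨ ×-assoc-* n 1√ v ⟨
  ⟦ n ⟧ ⊗ v             ∎
  where open ≡-Reasoning

sumBelow-window : ∀ a n r (f : ℕ → ℚ√2) v →
  (∀ i → i < a → f i ≡ 0√) → (∀ i → i < n → f (a + i) ≡ v) → (∀ i → f (a + (n + i)) ≡ 0√) →
  sumBelow (a + (n + r)) f ≡ (⟦ n ⟧ ⊗ v)
sumBelow-window a n r f v before inside after = begin
  sumBelow (a + (n + r)) f
    ≡⟨ sumBelow-+ a (n + r) f ⟩
  sumBelow a f ⊕ sumBelow (n + r) (λ i → f (a + i))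
    ≡⟨ cong₂ _⊕_ (sumBelow-zero a before) (sumBelow-+ n r (λ i → f (a + i))) ⟩
  0√ ⊕ (sumBelow n (λ i → f (a + i)) ⊕ sumBelow r (λ i → f (a + (n + i))))
    ≡⟨ cong₂ (λ s t → 0√ ⊕ (s ⊕ t)) (trans (sumBelow-cong n inside) (sumBelow-const n v))
                                     (sumBelow-zero r (λ i _ → after i)) ⟩
  0√ ⊕ ((⟦ n ⟧ ⊗ v) ⊕ 0√)
    ≡⟨ trans (⊕-identityˡ _) (⊕-identityʳ _) ⟩
  ⟦ n ⟧ ⊗ v
    ∎
  where open ≡-Reasoning

2^-nonZero : ∀ n → NonZero (2 ^ n)
2^-nonZero n = ℕP.m^n≢0 2 n

-- Instance search cannot find NonZero (2 ^ H) for a variable H, hence the explicit instances.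
_/2^_ : ℕ → ℕ → ℕ
i /2^ H = _/_ i (2 ^ H) {{2^-nonZero H}}

does-true⇒ : ∀ {P : Set} (p? : Dec P) → does p? ≡ true → P
does-true⇒ (yes p) _ = p

/2^-+ : ∀ i d H → i /2^ (d + H) ≡ (i /2^ H) /2^ d
/2^-+ i d H = begin
  i /2^ (d + H)          ≡⟨ /-congʳ (trans (ℕP.^-distribˡ-+-* 2 d H) (ℕP.*-comm (2 ^ d) (2 ^ H))) ⟩
  i / (2 ^ H * 2 ^ d)    ≡⟨ m/n/o≡m/[n*o] i (2 ^ H) (2 ^ d) ⟨
  (i /2^ H) /2^ d        ∎
  where
  open ≡-Reasoning
  instance
    _ = 2^-nonZero H
    _ = 2^-nonZero d
    _ = 2^-nonZero (d + H)
    _ = ℕP.m*n≢0 (2 ^ H) (2 ^ d)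

-- The test used by coord, so that coord k (h , j) i is block (toℕ h) (toℕ j) (toℕ i) by definition.
inBlock : ℕ → ℕ → ℕ → Bool
inBlock H J i = does ((J * 2 ^ H) ≤? i ×-dec (i <? (suc J) * 2 ^ H))

inBlock⇒/ : ∀ H J i → inBlock H J i ≡ true → i /2^ H ≡ J
inBlock⇒/ H J i i∈J = interval⇒/ (does-true⇒ ((J * 2 ^ H) ≤? i ×-dec (i <? (suc J) * 2 ^ H)) i∈J)
  where
  instance _ = 2^-nonZero H
  interval⇒/ : J * 2 ^ H ≤ i × i < suc J * 2 ^ H → i /2^ H ≡ J
  interval⇒/ (start≤i , i<end) = ℕP.≤-antisym
    (ℕP.≤-pred (m<n*o⇒m/o<n i<end))
    (subst (_≤ i /2^ H) (m*n/n≡m J (2 ^ H)) (/-monoˡ-≤ (2 ^ H) start≤i))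

/⇒inBlock : ∀ H J i → i /2^ H ≡ J → inBlock H J i ≡ true
/⇒inBlock H J i refl = dec-true (_ ≤? i ×-dec i <? _) (m/n*n≤m i (2 ^ H) , i<end)
  where
  instance _ = 2^-nonZero H
  i<end : i < suc (i / 2 ^ H) * 2 ^ H
  i<end = begin-strict
    i                                  ≡⟨ m≡m%n+[m/n]*n i (2 ^ H) ⟩
    i % 2 ^ H + (i / 2 ^ H) * 2 ^ H    <⟨ ℕP.+-monoˡ-< _ (m%n<n i (2 ^ H)) ⟩
    suc (i / 2 ^ H) * 2 ^ H            ∎
    where open ℕP.≤-Reasoning

inBlock-ancestor : ∀ H J d J' i → J /2^ d ≡ J' → inBlock H J i ≡ true → inBlock (d + H) J' i ≡ true
inBlock-ancestor H J d J' i J/2^d≡J' i∈J = /⇒inBlock (d + H) J' i (begin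
  i /2^ (d + H)      ≡⟨ /2^-+ i d H ⟩
  (i /2^ H) /2^ d    ≡⟨ cong (_/2^ d) (inBlock⇒/ H J i i∈J) ⟩
  J /2^ d            ≡⟨ J/2^d≡J' ⟩
  J'                 ∎)
  where open ≡-Reasoning

inBlock-nonAncestor : ∀ H J d J' i → J /2^ d ≢ J' → inBlock H J i ≡ true → inBlock (d + H) J' i ≡ false
inBlock-nonAncestor H J d J' i J/2^d≢J' i∈J = ¬-not λ i∈J' → J/2^d≢J' (begin
  J /2^ d            ≡⟨ cong (_/2^ d) (inBlock⇒/ H J i i∈J) ⟨
  (i /2^ H) /2^ d    ≡⟨ /2^-+ i d H ⟨
  i /2^ (d + H)      ≡⟨ inBlock⇒/ (d + H) J' i i∈J' ⟩
  J'                 ∎)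
  where open ≡-Reasoning

weight : ℕ → ℚ√2
weight = pow invSqrt2

block : ℕ → ℕ → ℕ → ℚ√2
block H J i = if inBlock H J i then weight H else 0√

Valid : ℕ → ℕ → ℕ → Set
Valid k H J = H ≤ k × J < 2 ^ (k ∸ H)

Valid⇒blockEnd≤2^k : ∀ {k H J} → Valid k H J → suc J * 2 ^ H ≤ 2 ^ k
Valid⇒blockEnd≤2^k {k} {H} {J} (H≤k , J<2^[k∸H]) = begin
  suc J * 2 ^ H          ≤⟨ ℕP.*-monoˡ-≤ (2 ^ H) J<2^[k∸H] ⟩
  2 ^ (k ∸ H) * 2 ^ H    ≡⟨ ℕP.^-distribˡ-+-* 2 (k ∸ H) H ⟨
  2 ^ (k ∸ H + H)        ≡⟨ cong (2 ^_) (ℕP.m∸n+n≡m H≤k) ⟩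
  2 ^ k                  ∎
  where open ℕP.≤-Reasoning

Valid-root : ∀ k → Valid k k 0
Valid-root k = ℕP.≤-refl , ℕP.m^n>0 2 (k ∸ k)

Valid-ancestor : ∀ {k H J} d → d + H ≤ k → Valid k H J → Valid k (d + H) (J /2^ d)
Valid-ancestor {k} {H} {J} d d+H≤k (_ , J<2^[k∸H]) = d+H≤k ,
  m<n*o⇒m/o<n {{2^-nonZero d}} (subst (J <_) 2^[k∸H]≡ J<2^[k∸H])
  where
  d≤k∸H : d ≤ k ∸ H
  d≤k∸H = ℕP.m+n≤o⇒m≤o∸n d d+H≤k
  2^[k∸H]≡ : 2 ^ (k ∸ H) ≡ 2 ^ (k ∸ (d + H)) * 2 ^ d
  2^[k∸H]≡ = begin
    2 ^ (k ∸ H)                   ≡⟨ cong (2 ^_) (ℕP.m∸n+n≡m d≤k∸H) ⟨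
    2 ^ (k ∸ H ∸ d + d)           ≡⟨ cong (λ e → 2 ^ (e + d)) (ℕP.∸-+-assoc k H d) ⟩
    2 ^ (k ∸ (H + d) + d)         ≡⟨ cong (λ e → 2 ^ (k ∸ e + d)) (ℕP.+-comm H d) ⟩
    2 ^ (k ∸ (d + H) + d)         ≡⟨ ℕP.^-distribˡ-+-* 2 (k ∸ (d + H)) d ⟩
    2 ^ (k ∸ (d + H)) * 2 ^ d     ∎
    where open ≡-Reasoning

sumBelow-block : ∀ {k H J} → Valid k H J → ∀ v →
  sumBelow (2 ^ k) (λ i → if inBlock H J i then v else 0√) ≡ (⟦ 2 ^ H ⟧ ⊗ v)
sumBelow-block {k} {H} {J} valid v =
  subst (λ N → sumBelow N f ≡ (⟦ n ⟧ ⊗ v)) a+[n+r]≡2^k (sumBelow-window a n r f v before inside after)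
  where
  a n r : ℕ
  a = J * 2 ^ H
  n = 2 ^ H
  r = 2 ^ k ∸ (n + a)
  f : ℕ → ℚ√2
  f i = if inBlock H J i then v else 0√
  a+[n+r]≡2^k : a + (n + r) ≡ 2 ^ k
  a+[n+r]≡2^k = trans (sym (ℕP.+-assoc a n r))
    (trans (cong (_+ r) (ℕP.+-comm a n)) (ℕP.m+[n∸m]≡n (Valid⇒blockEnd≤2^k valid)))
  before : ∀ i → i < a → f i ≡ 0√
  before i i<a = cong (λ b → if b then v else 0√)
    (dec-false (a ≤? i ×-dec i <? n + a) (λ (a≤i , _) → ℕP.<⇒≱ i<a a≤i))
  inside : ∀ i → i < n → f (a + i) ≡ v
  inside i i<n = cong (λ b → if b then v else 0√)
    (dec-true (a ≤? a + i ×-dec a + i <? n + a)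
      (ℕP.m≤m+n a i , subst (a + i <_) (ℕP.+-comm a n) (ℕP.+-monoʳ-< a i<n)))
  after : ∀ i → f (a + (n + i)) ≡ 0√
  after i = cong (λ b → if b then v else 0√)
    (dec-false (a ≤? a + (n + i) ×-dec a + (n + i) <? n + a)
      (λ (_ , i<n+a) → ℕP.<⇒≱ i<n+a
        (subst (_≤ a + (n + i)) (ℕP.+-comm a n) (ℕP.+-monoʳ-≤ a (ℕP.m≤m+n n i)))))

pow-+ : ∀ x m n → pow x (m + n) ≡ (pow x m ⊗ pow x n)
pow-+ x zero    n = sym (⊗-identityˡ (pow x n))
pow-+ x (suc m) n = trans (cong (x ⊗_) (pow-+ x m n)) (sym (⊗-assoc x (pow x m) (pow x n)))

⟦2^H⟧⊗weight²≡1 : ∀ H → (⟦ 2 ^ H ⟧ ⊗ (weight H ⊗ weight H)) ≡ 1√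
⟦2^H⟧⊗weight²≡1 zero    = refl
⟦2^H⟧⊗weight²≡1 (suc H) = begin
  ⟦ 2 * 2 ^ H ⟧ ⊗ ((invSqrt2 ⊗ w) ⊗ (invSqrt2 ⊗ w))
    ≡⟨ cong (_⊗ ((invSqrt2 ⊗ w) ⊗ (invSqrt2 ⊗ w))) (×1-homo-* 2 (2 ^ H)) ⟩
  (⟦ 2 ⟧ ⊗ ⟦ 2 ^ H ⟧) ⊗ ((invSqrt2 ⊗ w) ⊗ (invSqrt2 ⊗ w))
    ≡⟨ solve 4 (λ t n i w → (t :* n) :* ((i :* w) :* (i :* w)) := (t :* (i :* i)) :* (n :* (w :* w)))
         refl ⟦ 2 ⟧ ⟦ 2 ^ H ⟧ invSqrt2 w ⟩
  (⟦ 2 ⟧ ⊗ (invSqrt2 ⊗ invSqrt2)) ⊗ (⟦ 2 ^ H ⟧ ⊗ (w ⊗ w))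
    ≡⟨ cong ((⟦ 2 ⟧ ⊗ (invSqrt2 ⊗ invSqrt2)) ⊗_) (⟦2^H⟧⊗weight²≡1 H) ⟩
  1√
    ∎
  where
  open ≡-Reasoning
  w = weight H

⟦2^H⟧⊗weight⊗weight≡weight : ∀ d H → (⟦ 2 ^ H ⟧ ⊗ (weight H ⊗ weight (d + H))) ≡ weight d
⟦2^H⟧⊗weight⊗weight≡weight d H = begin
  ⟦ 2 ^ H ⟧ ⊗ (weight H ⊗ weight (d + H))
    ≡⟨ cong (λ z → ⟦ 2 ^ H ⟧ ⊗ (weight H ⊗ z)) (pow-+ invSqrt2 d H) ⟩
  ⟦ 2 ^ H ⟧ ⊗ (weight H ⊗ (weight d ⊗ weight H))
    ≡⟨ solve 3 (λ n w u → n :* (w :* (u :* w)) := (n :* (w :* w)) :* u)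
         refl ⟦ 2 ^ H ⟧ (weight H) (weight d) ⟩
  (⟦ 2 ^ H ⟧ ⊗ (weight H ⊗ weight H)) ⊗ weight d
    ≡⟨ cong (_⊗ weight d) (⟦2^H⟧⊗weight²≡1 H) ⟩
  1√ ⊗ weight d
    ≡⟨ ⊗-identityˡ (weight d) ⟩
  weight d
    ∎
  where open ≡-Reasoning

inner : ℕ → (ℕ → ℚ√2) → (ℕ → ℚ√2) → ℚ√2
inner N f g = sumBelow N (λ i → f i ⊗ g i)

sqDist : ℕ → (ℕ → ℚ√2) → (ℕ → ℚ√2) → ℚ√2
sqDist N f g = sumBelow N (λ i → (f i ⊖ g i) ⊗ (f i ⊖ g i))

sqDist-polarisation : ∀ N f g → sqDist N f g ≡ ((inner N f f ⊕ inner N g g) ⊖ (two ⊗ inner N f g))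
sqDist-polarisation N f g = begin
  sqDist N f g
    ≡⟨ sumBelow-cong N (λ i _ → square-diff (f i) (g i)) ⟩
  sumBelow N (λ i → (ff i ⊕ gg i) ⊕ ((⊝ two) ⊗ fg i))
    ≡⟨ ∑-distrib-+ {N} (λ i → ff (toℕ i) ⊕ gg (toℕ i)) (λ i → (⊝ two) ⊗ fg (toℕ i)) ⟩
  sumBelow N (λ i → ff i ⊕ gg i) ⊕ sumBelow N (λ i → (⊝ two) ⊗ fg i)
    ≡⟨ cong₂ _⊕_ (∑-distrib-+ {N} (λ i → ff (toℕ i)) (λ i → gg (toℕ i)))
                 (sym (*-distribˡ-sum {N} (⊝ two) (λ i → fg (toℕ i)))) ⟩
  (inner N f f ⊕ inner N g g) ⊕ ((⊝ two) ⊗ inner N f g)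
    ≡⟨ solve 3 (λ a b c → (a :+ b) :+ (con (⊝ two) :* c) := (a :+ b) :- (con two :* c))
         refl (inner N f f) (inner N g g) (inner N f g) ⟩
  (inner N f f ⊕ inner N g g) ⊖ (two ⊗ inner N f g)
    ∎
  where
  open ≡-Reasoning
  ff gg fg : ℕ → ℚ√2
  ff i = f i ⊗ f i
  gg i = g i ⊗ g i
  fg i = f i ⊗ g i
  square-diff : ∀ x y → ((x ⊖ y) ⊗ (x ⊖ y)) ≡ (((x ⊗ x) ⊕ (y ⊗ y)) ⊕ ((⊝ two) ⊗ (x ⊗ y)))
  square-diff = solve 2 (λ x y → (x :- y) :* (x :- y) := ((x :* x) :+ (y :* y)) :+ (con (⊝ two) :* (x :* y))) refl

block⊗block-nested : ∀ H J H' J' i → (inBlock H J i ≡ true → inBlock H' J' i ≡ true) →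
  (block H J i ⊗ block H' J' i) ≡ (if inBlock H J i then weight H ⊗ weight H' else 0√)
block⊗block-nested H J H' J' i J⊆J' with inBlock H J i
... | true  rewrite J⊆J' refl = refl
... | false = zeroˡ (block H' J' i)

block⊗block-disjoint : ∀ H J H' J' i → (inBlock H J i ≡ true → inBlock H' J' i ≡ false) →
  (block H J i ⊗ block H' J' i) ≡ 0√
block⊗block-disjoint H J H' J' i J∩J'≡∅ with inBlock H J i
... | true  rewrite J∩J'≡∅ refl = zeroʳ (weight H)
... | false = zeroˡ (block H' J' i)

inner-block-ancestor : ∀ {k H J} d {J'} → Valid k H J → J /2^ d ≡ J' →
  inner (2 ^ k) (block H J) (block (d + H) J') ≡ weight d
inner-block-ancestor {k} {H} {J} d {J'} valid J/2^d≡J' = begin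
  inner (2 ^ k) (block H J) (block (d + H) J')
    ≡⟨ sumBelow-cong (2 ^ k) (λ i _ →
         block⊗block-nested H J (d + H) J' i (inBlock-ancestor H J d J' i J/2^d≡J')) ⟩
  sumBelow (2 ^ k) (λ i → if inBlock H J i then weight H ⊗ weight (d + H) else 0√)
    ≡⟨ sumBelow-block valid (weight H ⊗ weight (d + H)) ⟩
  ⟦ 2 ^ H ⟧ ⊗ (weight H ⊗ weight (d + H))
    ≡⟨ ⟦2^H⟧⊗weight⊗weight≡weight d H ⟩
  weight d
    ∎
  where open ≡-Reasoning

inner-block-self : ∀ {k H J} → Valid k H J → inner (2 ^ k) (block H J) (block H J) ≡ 1√
inner-block-self {J = J} valid = inner-block-ancestor 0 valid (n/1≡n J)

inner-block-nonAncestor : ∀ {k} H J d J' → J /2^ d ≢ J' →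
  inner (2 ^ k) (block H J) (block (d + H) J') ≡ 0√
inner-block-nonAncestor {k} H J d J' J/2^d≢J' = sumBelow-zero (2 ^ k) (λ i _ →
  block⊗block-disjoint H J (d + H) J' i (inBlock-nonAncestor H J d J' i J/2^d≢J'))

-- ‖x - y‖² for unit vectors x, y with ⟨x , y⟩ = z.
unitDist² : ℚ√2 → ℚ√2
unitDist² z = two ⊖ (two ⊗ z)

blockDist² : ℕ → ℕ → ℕ → ℕ → ℕ → ℚ√2
blockDist² k H J H' J' = sqDist (2 ^ k) (block H J) (block H' J')

blockDist²≡unitDist²-inner : ∀ {k H J H' J'} → Valid k H J → Valid k H' J' →
  blockDist² k H J H' J' ≡ unitDist² (inner (2 ^ k) (block H J) (block H' J'))
blockDist²≡unitDist²-inner {k} {H} {J} {H'} {J'} valid valid' = trans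
  (sqDist-polarisation (2 ^ k) (block H J) (block H' J'))
  (cong₂ (λ a b → (a ⊕ b) ⊖ (two ⊗ inner (2 ^ k) (block H J) (block H' J')))
    (inner-block-self valid) (inner-block-self valid'))

blockDist²-ancestor : ∀ {k H J H' J'} d → d + H ≡ H' → Valid k H J → Valid k H' J' →
  J /2^ d ≡ J' → blockDist² k H J H' J' ≡ unitDist² (weight d)
blockDist²-ancestor d refl valid valid' J/2^d≡J' =
  trans (blockDist²≡unitDist²-inner valid valid')
    (cong unitDist² (inner-block-ancestor d valid J/2^d≡J'))

blockDist²-nonAncestor : ∀ {k H J H' J'} d → d + H ≡ H' → Valid k H J → Valid k H' J' →
  J /2^ d ≢ J' → blockDist² k H J H' J' ≡ unitDist² 0√
blockDist²-nonAncestor {k} {H} {J} {_} {J'} d refl valid valid' J/2^d≢J' =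
  trans (blockDist²≡unitDist²-inner valid valid')
    (cong unitDist² (inner-block-nonAncestor {k} H J d J' J/2^d≢J'))

blockDist²-comm : ∀ k H J H' J' → blockDist² k H J H' J' ≡ blockDist² k H' J' H J
blockDist²-comm k H J H' J' = sumBelow-cong (2 ^ k) (λ i _ →
  solve 2 (λ x y → (x :- y) :* (x :- y) := (y :- x) :* (y :- x)) refl (block H J i) (block H' J' i))

weight-shape : ∀ m → ∃[ q ] (0ℚ Q.< q × (weight m ≡ fromℚ q ⊎ weight m ≡ (fromℚ q ⊗ sqrt2)))
weight-shape zero = 1ℚ , QP.positive⁻¹ 1ℚ , inj₁ refl
weight-shape (suc m) with weight-shape m
... | q , q>0 , inj₁ w≡q =
  ½ Q.* q , QP.positive⁻¹ (½ Q.* q) {{QP.pos*pos⇒pos ½ q {{Q.positive q>0}}}} ,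
  inj₂ (trans (cong (invSqrt2 ⊗_) w≡q) (invSqrt2⊗fromℚ q))
... | q , q>0 , inj₂ w≡q√2 =
  q , q>0 , inj₁ (trans (cong (invSqrt2 ⊗_) w≡q√2) (invSqrt2⊗fromℚ⊗sqrt2 q))

Pos-weight⊗ : ∀ {y} → Pos y → Pos (sqrt2 ⊗ y) → ∀ m → Pos (weight m ⊗ y)
Pos-weight⊗ {y} pos pos√2 m with weight-shape m
... | q , q>0 , inj₁ w≡q = subst Pos (cong (_⊗ y) (sym w≡q)) (Pos-fromℚ⊗ y q>0 pos)
... | q , q>0 , inj₂ w≡q√2 = subst Pos
  (trans (sym (⊗-assoc (fromℚ q) sqrt2 y)) (cong (_⊗ y) (sym w≡q√2)))
  (Pos-fromℚ⊗ (sqrt2 ⊗ y) q>0 pos√2)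

unitDist²-weight<unitDist²-weight-suc : ∀ m → unitDist² (weight m) <√ unitDist² (weight (suc m))
unitDist²-weight<unitDist²-weight-suc m = subst Pos
  (solve 2 (λ w i → w :* (con two :- con two :* i) := (con two :- con two :* (i :* w)) :- (con two :- con two :* w))
     refl (weight m) invSqrt2)
  (Pos-weight⊗ (toWitness {a? = Pos? two-√2} tt) (toWitness {a? = Pos? (sqrt2 ⊗ two-√2)} tt) m)
  where
  two-√2 : ℚ√2
  two-√2 = two ⊖ (two ⊗ invSqrt2)

unitDist²-weight<unitDist²-0 : ∀ m → unitDist² (weight m) <√ unitDist² 0√
unitDist²-weight<unitDist²-0 m = subst Pos
  (solve 1 (λ w → w :* con two := (con two :- con two :* con 0√) :- (con two :- con two :* w)) refl (weight m))
  (Pos-weight⊗ (toWitness {a? = Pos? two} tt) (toWitness {a? = Pos? (sqrt2 ⊗ two)} tt) m)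

unitDist²-weight-0≯0 : ¬ (0√ <√ unitDist² (weight 0))
unitDist²-weight-0≯0 = toWitnessFalse {a? = Pos? (unitDist² (weight 0) ⊖ 0√)} tt

blockDist²-root : ∀ {k H J} → Valid k H J → blockDist² k k 0 H J ≡ unitDist² (weight (k ∸ H))
blockDist²-root {k} {H} {J} valid@(H≤k , J<2^[k∸H]) = trans (blockDist²-comm k k 0 H J)
  (blockDist²-ancestor (k ∸ H) (ℕP.m∸n+n≡m H≤k) valid (Valid-root k)
    (m<n⇒m/n≡0 {{2^-nonZero (k ∸ H)}} J<2^[k∸H]))

even-or-odd : ∀ c → c ≡ (c /2^ 1) * 2 ⊎ c ≡ suc ((c /2^ 1) * 2)
even-or-odd c with c % 2 | m≡m%n+[m/n]*n c 2 | m%n<n c 2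
... | 0           | c≡ | _ = inj₁ c≡
... | 1           | c≡ | _ = inj₂ c≡
... | suc (suc _) | _  | s≤s (s≤s ())

children : ℕ → ℕ → List (ℕ × ℕ)
children H J = (H , J * 2) ∷ (H , suc (J * 2)) ∷ []

neighbours : ℕ → ℕ → ℕ → List (ℕ × ℕ)
neighbours k H J = (k , 0) ∷ (suc H , J /2^ 1) ∷ children (H ∸ 1) J

any-children : ∀ {P : ℕ × ℕ → Set} {H J} c → c /2^ 1 ≡ J → P (H , c) → Any P (children H J)
any-children {P} {H} c c/2≡J p with even-or-odd c
... | inj₁ c≡ = here (subst (λ x → P (H , x)) (trans c≡ (cong (_* 2) c/2≡J)) p)
... | inj₂ c≡ = there (here (subst (λ x → P (H , x)) (trans c≡ (cong (λ x → suc (x * 2)) c/2≡J)) p))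

Closer : ℕ → ℕ → ℕ → ℕ → ℕ → ℕ × ℕ → Set
Closer k H J H' J' (H″ , J″) = Valid k H″ J″ × (blockDist² k H″ J″ H' J' <√ blockDist² k H J H' J')

via-root : ∀ {k H J H' J'} → Valid k H' J' → blockDist² k H J H' J' ≡ unitDist² 0√ →
  Any (Closer k H J H' J') (neighbours k H J)
via-root {k} {H' = H'} valid' dist≡ = here (Valid-root k ,
  subst₂ _<√_ (sym (blockDist²-root valid')) (sym dist≡) (unitDist²-weight<unitDist²-0 (k ∸ H')))

via-parent : ∀ {k H J H' J'} m → suc m + H ≡ H' → Valid k H J → Valid k H' J' → J /2^ suc m ≡ J' →
  Closer k H J H' J' (suc H , J /2^ 1)
via-parent {k} {H} {J} {_} {J'} m refl valid valid'@(H'≤k , _) J/2^d≡J' = valid-parent ,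
  subst₂ _<√_ (sym parent-dist) (sym self-dist) (unitDist²-weight<unitDist²-weight-suc m)
  where
  valid-parent : Valid k (suc H) (J /2^ 1)
  valid-parent = Valid-ancestor 1 (ℕP.≤-trans (s≤s (ℕP.m≤n+m H m)) H'≤k) valid
  self-dist : blockDist² k H J (suc m + H) J' ≡ unitDist² (weight (suc m))
  self-dist = blockDist²-ancestor (suc m) refl valid valid' J/2^d≡J'
  parent-dist : blockDist² k (suc H) (J /2^ 1) (suc m + H) J' ≡ unitDist² (weight m)
  parent-dist = blockDist²-ancestor m (ℕP.+-suc m H) valid-parent valid'
    (trans (sym (/2^-+ J m 1)) (trans (cong (J /2^_) (ℕP.+-comm m 1)) J/2^d≡J'))

via-child : ∀ {k H J H' J'} m → suc m + H' ≡ H → Valid k H J → Valid k H' J' → J' /2^ suc m ≡ J →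
  Any (Closer k H J H' J') (children (H ∸ 1) J)
via-child {k} {_} {J} {H'} {J'} m refl valid@(H≤k , _) valid' J'/2^d≡J =
  any-children {Closer k (suc m + H') J H' J'} (J' /2^ m) (trans (sym (/2^-+ J' 1 m)) J'/2^d≡J)
    (valid-child , subst₂ _<√_ (sym child-dist) (sym self-dist) (unitDist²-weight<unitDist²-weight-suc m))
  where
  valid-child : Valid k (m + H') (J' /2^ m)
  valid-child = Valid-ancestor m (ℕP.≤-trans (ℕP.n≤1+n (m + H')) H≤k) valid'
  self-dist : blockDist² k (suc m + H') J H' J' ≡ unitDist² (weight (suc m))
  self-dist = trans (blockDist²-comm k (suc m + H') J H' J')
    (blockDist²-ancestor (suc m) refl valid' valid J'/2^d≡J)
  child-dist : blockDist² k (m + H') (J' /2^ m) H' J' ≡ unitDist² (weight m)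
  child-dist = trans (blockDist²-comm k (m + H') (J' /2^ m) H' J')
    (blockDist²-ancestor m refl valid' valid-child refl)

closer-neighbour-above : ∀ {k H J H' J'} d → d + H ≡ H' → Valid k H J → Valid k H' J' →
  0√ <√ blockDist² k H J H' J' →
  Any (Closer k H J H' J') (neighbours k H J)
closer-neighbour-above {k} {H} {J} {H'} {J'} d d+H≡H' valid valid' 0<dist with J /2^ d ℕ.≟ J'
... | no J/2^d≢J' = via-root {k} {H} {J} {H'} {J'} valid'
  (blockDist²-nonAncestor d d+H≡H' valid valid' J/2^d≢J')
closer-neighbour-above zero    d+H≡H' valid valid' 0<dist | yes J/2^d≡J' =
  ⊥-elim (unitDist²-weight-0≯0
    (subst (0√ <√_) (blockDist²-ancestor 0 d+H≡H' valid valid' J/2^d≡J') 0<dist))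
closer-neighbour-above (suc m) d+H≡H' valid valid' 0<dist | yes J/2^d≡J' =
  there (here (via-parent m d+H≡H' valid valid' J/2^d≡J'))

closer-neighbour-below : ∀ {k H J H' J'} d → d + H' ≡ H → H' < H → Valid k H J → Valid k H' J' →
  Any (Closer k H J H' J') (neighbours k H J)
closer-neighbour-below {k} {H} {J} {H'} {J'} d d+H'≡H H'<H valid valid' with J' /2^ d ℕ.≟ J
... | no J'/2^d≢J = via-root {k} {H} {J} {H'} {J'} valid'
  (trans (blockDist²-comm k H J H' J') (blockDist²-nonAncestor d d+H'≡H valid' valid J'/2^d≢J))
closer-neighbour-below zero    refl H'<H valid valid' | yes _ = ⊥-elim (ℕP.<-irrefl refl H'<H)
closer-neighbour-below (suc m) d+H'≡H H'<H valid valid' | yes J'/2^d≡J =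
  there (there (via-child m d+H'≡H valid valid' J'/2^d≡J))

closer-neighbour : ∀ {k H J H' J'} → Valid k H J → Valid k H' J' → 0√ <√ blockDist² k H J H' J' →
  Any (Closer k H J H' J') (neighbours k H J)
closer-neighbour {H = H} {H' = H'} valid valid' 0<dist with H ≤? H'
... | yes H≤H' = closer-neighbour-above (H' ∸ H) (ℕP.m∸n+n≡m H≤H') valid valid' 0<dist
... | no  H≰H' = closer-neighbour-below (H ∸ H') (ℕP.m∸n+n≡m (ℕP.<⇒≤ H'<H)) H'<H valid valid'
  where H'<H = ℕP.≰⇒> H≰H'

level index : ∀ {k} → Point k → ℕ
level (h , _) = toℕ h
index (_ , j) = toℕ j

Valid-point : ∀ {k} (p : Point k) → Valid k (level p) (index p)
Valid-point (h , j) = ℕP.≤-pred (toℕ<n h) , toℕ<n j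

dist²≡blockDist² : ∀ {k} (p q : Point k) →
  dist² k p q ≡ blockDist² k (level p) (index p) (level q) (index q)
dist²≡blockDist² {k} (h , j) (h' , j') = sumFin≡sum (2 ^ k) _

toPoint : ∀ {k H J} → Valid k H J → Point k
toPoint {k} {H} {J} (H≤k , J<2^[k∸H]) =
  fromℕ< (s≤s H≤k) , fromℕ< (subst (λ x → J < 2 ^ (k ∸ x)) (sym (toℕ-fromℕ< (s≤s H≤k))) J<2^[k∸H])

level-toPoint : ∀ {k H J} (valid : Valid k H J) → level (toPoint valid) ≡ H
level-toPoint (H≤k , _) = toℕ-fromℕ< (s≤s H≤k)

index-toPoint : ∀ {k H J} (valid : Valid k H J) → index (toPoint valid) ≡ J
index-toPoint _ = toℕ-fromℕ< _

dist²-toPoint : ∀ {k H J} (valid : Valid k H J) (t : Point k) →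
  dist² k (toPoint valid) t ≡ blockDist² k H J (level t) (index t)
dist²-toPoint {k} valid t = trans (dist²≡blockDist² (toPoint valid) t)
  (cong₂ (λ A B → blockDist² k A B (level t) (index t)) (level-toPoint valid) (index-toPoint valid))

Valid? : ∀ k H J → Dec (Valid k H J)
Valid? k H J = H ≤? k ×-dec J <? 2 ^ (k ∸ H)

-- Coordinates outside P (the parent of the root, the children of a leaf) fall back to s itself.
pointOr : ∀ {k} → Point k → ℕ × ℕ → Point k
pointOr {k} s (H , J) with Valid? k H J
... | yes valid = toPoint valid
... | no  _     = s

dist²-pointOr : ∀ {k H J} (s t : Point k) → Valid k H J →
  dist² k (pointOr s (H , J)) t ≡ blockDist² k H J (level t) (index t)
dist²-pointOr {k} {H} {J} s t valid with Valid? k H J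
... | yes valid′ = dist²-toPoint valid′ t
... | no  ¬valid = ⊥-elim (¬valid valid)

navGraph : (k : ℕ) → Graph k
navGraph k s = map (pointOr s) (neighbours k (level s) (index s))

navGraph-navigable : ∀ k → OneNavigable k (navGraph k)
navGraph-navigable k s t 0<dist = find (map⁺ {f = pointOr s} {P = λ u → dist² k u t <√ dist² k s t}
  (Any.map closer⇒ (closer-neighbour (Valid-point s) (Valid-point t)
    (subst (0√ <√_) (dist²≡blockDist² s t) 0<dist))))
  where
  closer⇒ : ∀ {v} → Closer k (level s) (index s) (level t) (index t) v →
    dist² k (pointOr s v) t <√ dist² k s t
  closer⇒ {H , J} (valid , closer) =
    subst₂ _<√_ (sym (dist²-pointOr {k} {H} {J} s t valid)) (sym (dist²≡blockDist² s t)) closer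

navGraph-outDegree : ∀ k → MaxOutDegree≤ k (navGraph k) (4 * (1 + k))
navGraph-outDegree k s = ℕP.m≤m*n 4 (1 + k)

lemma3p5 : ∃[ C ] (∀ (k : ℕ) → ∃[ G ] (OneNavigable k G × MaxOutDegree≤ k G (C * (1 + k))))
lemma3p5 = 4 , λ k → navGraph k , navGraph-navigable k , navGraph-outDegree k
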